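{- Let $v$ be a node of a labeled graph $G$. Then the set of standard decompositions of $G$ equals \[\{\mathcal H\cup\mathcal H' : \mathcal H \text{ a standard } v\text{ -decomposition of } G,\ \mathcal H' \text{ a standard decomposition of } G\ominus\textstyle\sum\mathcal H\},\] (multiset union) and no decomposition arises twice on the right-hand side, i.e. distinct pairs $(\mathcal H,\mathcal H')$ give distinct multisets $\mathcal H\cup\mathcal H'$.
   Context: A labeled graph $G$: finite node set, directed edges without loops, integer labeling $\ell_G$. $G$ is standard if labels are $\ge0$ and $\ell_G(a)\le\ell_G(b)$ for each edge $(a,b)$. For graphs with the same nodes and edges, $\oplus,\ominus$ add/subtract labels nodewise; $\sum\mathcal H$ is the sum of a finite multiset (zero labeling if empty). A standard component of $G$ is a labeled graph $H$ with the same nodes and edges as $G$, labels in $\{0,1\}$, $H$ standard, $G\ominus H$ standard, not all labels of $H$ zero. A standard decomposition of $G$ is a finite multiset of standard components of $G$ with sum $G$. A standard $v$-decomposition of $G$ is a finite multiset $\mathcal H$ such that each $H\in\mathcal H$ is a standard component of $G$ with $\ell_H(v)=1$, $G\ominus\sum\mathcal H$ is standard, and $|\mathcal H|=\ell_G(v)$ (counted with multiplicity). -}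

module Defs where

open import Data.Nat using (ℕ)
open import Data.Integer using (ℤ; +_; _+_; _-_; _≤_)
open import Data.Fin using (Fin)
open import Data.Vec using (Vec; lookup; zipWith; replicate)
open import Data.List using (List; foldr; length; _++_)
open import Data.List.Relation.Unary.All using (All)
open import Data.Product using (_×_; Σ; ∃; ∃₂; _,_; proj₁; proj₂)
open import Data.Sum using (_⊎_)
open import Relation.Binary.PropositionalEquality using (_≡_; _≢_)

-- A labeled graph on nodes Fin n: an edge list E (directed, no loops,
-- the no-loop condition is a separate hypothesis) and a labeling Vec ℤ n.
-- Graphs "with the same nodes and edges" share n and E; only labels vary.

Edges : ℕ → Set
Edges n = List (Fin n × Fin n)

NoLoops : ∀ {n} → Edges n → Set
NoLoops E = All (λ e → proj₁ e ≢ proj₂ e) E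

Labeling : ℕ → Set
Labeling n = Vec ℤ n

_⊕_ : ∀ {n} → Labeling n → Labeling n → Labeling n
_⊕_ = zipWith _+_

_⊖_ : ∀ {n} → Labeling n → Labeling n → Labeling n
_⊖_ = zipWith _-_

Σᴸ : ∀ {n} → List (Labeling n) → Labeling n
Σᴸ {n} = foldr _⊕_ (replicate n (+ 0))

Standard : ∀ {n} → Edges n → Labeling n → Set
Standard E ℓ = (∀ i → + 0 ≤ lookup ℓ i) × All (λ e → lookup ℓ (proj₁ e) ≤ lookup ℓ (proj₂ e)) E

StdComponent : ∀ {n} → Edges n → Labeling n → Labeling n → Set
StdComponent E G H =
  (∀ i → lookup H i ≡ + 0 ⊎ lookup H i ≡ + 1)
  × Standard E H
  × Standard E (G ⊖ H)
  × ∃ (λ i → lookup H i ≢ + 0)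

-- standard decomposition of G (multisets as lists, compared up to permutation)
StdDecomp : ∀ {n} → Edges n → Labeling n → List (Labeling n) → Set
StdDecomp E G M = All (StdComponent E G) M × Σᴸ M ≡ G

StdVDecomp : ∀ {n} → Edges n → Labeling n → Fin n → List (Labeling n) → Set
StdVDecomp E G v M =
  All (λ H → StdComponent E G H × lookup H v ≡ + 1) M
  × Standard E (G ⊖ Σᴸ M)
  × + (length M) ≡ lookup G v

module Submission where

-- Given a standard
-- decomposition M of G, the members with label 1 at v form a standard
-- v-decomposition H (their number is ℓ_G(v), since the labels at v add up
-- to ℓ_G(v)), and the remaining members form a standard decomposition of
-- G ⊖ ΣH, because a standard component of a sum is one of its own sum of
-- components.  Conversely, a component of G ⊖ S with S standard is a
-- component of G, so H ++ H′ is a standard decomposition of G.  Finally,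
-- for any such pair (H, H′) the components of H′ vanish at v (their labels
-- at v are non-negative and add up to ℓ_G(v) − |H| = 0), so H and H′ are
-- recovered from H ++ H′ by filtering on "label 1 at v"; filtering respects
-- permutations, which gives uniqueness.

open import Defs
open import Data.Fin using (Fin)
open import Data.List using (List; _++_)
open import Data.List.Relation.Binary.Permutation.Propositional using (_↭_)
open import Data.Product using (_×_; ∃₂)
open import Function.Bundles using (_⇔_)

open import Data.Nat using (ℕ)
import Data.Nat.Properties as ℕP
open import Data.Integer using (ℤ; +_; _+_; _-_; -_; _≤_; +≤+; _≟_)
import Data.Integer.Properties as ℤP
open import Data.Integer.Tactic.RingSolver using (solve-∀)
open import Data.Vec using ([]; _∷_; lookup; replicate)
open import Data.Vec.Properties
  using (lookup-zipWith; lookup-replicate; zipWith-identityˡ; zipWith-assoc; zipWith-comm)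
open import Data.List using ([]; _∷_; filter; length)
import Data.List.Properties as LP
open import Data.List.Relation.Unary.All as All using (All; []; _∷_)
import Data.List.Relation.Unary.All.Properties as AllP
open import Data.List.Relation.Binary.Permutation.Propositional
  using (refl; prep; swap; trans; ↭-sym; ↭-trans)
open import Data.List.Relation.Binary.Permutation.Propositional.Properties
  using (All-resp-↭; filter-↭; shift)
open import Data.Product using (_,_; proj₁; proj₂)
open import Data.Sum using (_⊎_; inj₁; inj₂)
open import Data.Empty using (⊥-elim)
open import Relation.Nullary using (yes; no)
open import Relation.Unary using (Pred; Decidable; ∁)
open import Relation.Unary.Properties using (∁?)
open import Relation.Binary.PropositionalEquality
  using (_≡_; _≢_; refl; sym; cong; cong₂; subst; subst₂; module ≡-Reasoning)
  renaming (trans to ≡-trans)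
open import Function.Bundles using (mk⇔)
open import Level using (0ℓ)

zeroᴸ : (n : ℕ) → Labeling n
zeroᴸ n = replicate n (+ 0)

lookup-⊕ : ∀ {n} (x y : Labeling n) i → lookup (x ⊕ y) i ≡ lookup x i + lookup y i
lookup-⊕ x y i = lookup-zipWith _+_ i x y

lookup-⊖ : ∀ {n} (x y : Labeling n) i → lookup (x ⊖ y) i ≡ lookup x i - lookup y i
lookup-⊖ x y i = lookup-zipWith _-_ i x y

⊕-identityˡ : ∀ {n} (x : Labeling n) → zeroᴸ n ⊕ x ≡ x
⊕-identityˡ = zipWith-identityˡ ℤP.+-identityˡ

⊕-assoc : ∀ {n} (x y z : Labeling n) → (x ⊕ y) ⊕ z ≡ x ⊕ (y ⊕ z)
⊕-assoc = zipWith-assoc ℤP.+-assoc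

⊕-comm : ∀ {n} (x y : Labeling n) → x ⊕ y ≡ y ⊕ x
⊕-comm = zipWith-comm ℤP.+-comm

⊕-⊖-assoc : ∀ {n} (x y z : Labeling n) → (x ⊕ y) ⊖ z ≡ x ⊕ (y ⊖ z)
⊕-⊖-assoc []      []      []      = refl
⊕-⊖-assoc (a ∷ x) (b ∷ y) (c ∷ z) = cong₂ _∷_ (ℤP.+-assoc a b (- c)) (⊕-⊖-assoc x y z)

⊕-⊖-cancelˡ : ∀ {n} (x y : Labeling n) → (x ⊕ y) ⊖ x ≡ y
⊕-⊖-cancelˡ []      []      = refl
⊕-⊖-cancelˡ (a ∷ x) (b ∷ y) = cong₂ _∷_ (cancel a b) (⊕-⊖-cancelˡ x y)
  where
  cancel : ∀ a b → (a + b) - a ≡ b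
  cancel = solve-∀

⊕-⊖-restore : ∀ {n} (x y : Labeling n) → x ⊕ (y ⊖ x) ≡ y
⊕-⊖-restore []      []      = refl
⊕-⊖-restore (a ∷ x) (b ∷ y) = cong₂ _∷_ (restore a b) (⊕-⊖-restore x y)
  where
  restore : ∀ a b → a + (b - a) ≡ b
  restore = solve-∀

⊖-unique : ∀ {n} {g x y : Labeling n} → x ⊕ y ≡ g → g ⊖ x ≡ y
⊖-unique {x = x} {y} refl = ⊕-⊖-cancelˡ x y

Σᴸ-++ : ∀ {n} (A B : List (Labeling n)) → Σᴸ (A ++ B) ≡ Σᴸ A ⊕ Σᴸ B
Σᴸ-++ []      B = sym (⊕-identityˡ (Σᴸ B))
Σᴸ-++ (a ∷ A) B = ≡-trans (cong (a ⊕_) (Σᴸ-++ A B)) (sym (⊕-assoc a (Σᴸ A) (Σᴸ B)))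

Σᴸ-↭ : ∀ {n} {A B : List (Labeling n)} → A ↭ B → Σᴸ A ≡ Σᴸ B
Σᴸ-↭ refl         = refl
Σᴸ-↭ (prep x p)   = cong (x ⊕_) (Σᴸ-↭ p)
Σᴸ-↭ (swap x y p) = ≡-trans (cong (λ s → x ⊕ (y ⊕ s)) (Σᴸ-↭ p)) (left-comm x y _)
  where
  open ≡-Reasoning
  left-comm : ∀ {n} (x y z : Labeling n) → x ⊕ (y ⊕ z) ≡ y ⊕ (x ⊕ z)
  left-comm x y z = begin
    x ⊕ (y ⊕ z)  ≡⟨ sym (⊕-assoc x y z) ⟩
    (x ⊕ y) ⊕ z  ≡⟨ cong (_⊕ z) (⊕-comm x y) ⟩
    (y ⊕ x) ⊕ z  ≡⟨ ⊕-assoc y x z ⟩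
    y ⊕ (x ⊕ z)  ∎
Σᴸ-↭ (trans p q)  = ≡-trans (Σᴸ-↭ p) (Σᴸ-↭ q)

standard-zero : ∀ {n} (E : Edges n) → Standard E (zeroᴸ n)
standard-zero {n} E = (λ i → ℤP.≤-reflexive (sym (lookup-replicate i (+ 0))))
                    , All.tabulate (λ {e} _ → ℤP.≤-reflexive (same-label e))
  where
  same-label : ∀ e → lookup (zeroᴸ n) (proj₁ e) ≡ lookup (zeroᴸ n) (proj₂ e)
  same-label (a , b) = ≡-trans (lookup-replicate a (+ 0)) (sym (lookup-replicate b (+ 0)))

standard-⊕ : ∀ {n} {E : Edges n} (x y : Labeling n) →
  Standard E x → Standard E y → Standard E (x ⊕ y)
standard-⊕ x y (x≥0 , x↗) (y≥0 , y↗) = nonneg , All.zipWith monotone (x↗ , y↗)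
  where
  nonneg : ∀ i → + 0 ≤ lookup (x ⊕ y) i
  nonneg i = subst (+ 0 ≤_) (sym (lookup-⊕ x y i)) (ℤP.+-mono-≤ (x≥0 i) (y≥0 i))
  monotone : ∀ {e} →
    lookup x (proj₁ e) ≤ lookup x (proj₂ e) × lookup y (proj₁ e) ≤ lookup y (proj₂ e) →
    lookup (x ⊕ y) (proj₁ e) ≤ lookup (x ⊕ y) (proj₂ e)
  monotone {a , b} (xab , yab) =
    subst₂ _≤_ (sym (lookup-⊕ x y a)) (sym (lookup-⊕ x y b)) (ℤP.+-mono-≤ xab yab)

standard-Σᴸ : ∀ {n} {E : Edges n} {L : List (Labeling n)} →
  All (Standard E) L → Standard E (Σᴸ L)
standard-Σᴸ {E = E} []       = standard-zero E
standard-Σᴸ {L = x ∷ L} (s ∷ ss) = standard-⊕ x (Σᴸ L) s (standard-Σᴸ ss)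

standard-Σᴸ-minus-member : ∀ {n} {E : Edges n} {L : List (Labeling n)} →
  All (Standard E) L → All (λ x → Standard E (Σᴸ L ⊖ x)) L
standard-Σᴸ-minus-member                     []       = []
standard-Σᴸ-minus-member {E = E} {y ∷ L} (s ∷ ss) =
  subst (Standard E) (sym (⊕-⊖-cancelˡ y (Σᴸ L))) (standard-Σᴸ ss)
  ∷ All.map (λ {x} rest → subst (Standard E) (sym (⊕-⊖-assoc y (Σᴸ L) x))
                                 (standard-⊕ y (Σᴸ L ⊖ x) s rest))
            (standard-Σᴸ-minus-member ss)

components-standard : ∀ {n} {E : Edges n} (G : Labeling n) {L : List (Labeling n)} →
  All (StdComponent E G) L → All (Standard E) L
components-standard _ = All.map (λ (_ , standard , _) → standard)

decomposes-own-sum : ∀ {n} {E : Edges n} (G : Labeling n) {L : List (Labeling n)} →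
  All (StdComponent E G) L → StdDecomp E (Σᴸ L) L
decomposes-own-sum G comps =
  All.zipWith (λ { ((binary , standard , _ , nonzero) , rest) → binary , standard , rest , nonzero })
              (comps , standard-Σᴸ-minus-member (components-standard G comps))
  , refl

component-lift : ∀ {n} {E : Edges n} (G S : Labeling n) → Standard E S →
  ∀ {H} → StdComponent E (G ⊖ S) H → StdComponent E G H
component-lift {E = E} G S S-std {H} (binary , standard , rest , nonzero) =
  binary , standard , subst (Standard E) G⊖H-split (standard-⊕ S ((G ⊖ S) ⊖ H) S-std rest) , nonzero
  where
  open ≡-Reasoning
  G⊖H-split : S ⊕ ((G ⊖ S) ⊖ H) ≡ G ⊖ H
  G⊖H-split = begin
    S ⊕ ((G ⊖ S) ⊖ H)  ≡⟨ sym (⊕-⊖-assoc S (G ⊖ S) H) ⟩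
    (S ⊕ (G ⊖ S)) ⊖ H  ≡⟨ cong (_⊖ H) (⊕-⊖-restore S G) ⟩
    G ⊖ H              ∎

↭-filter-split : ∀ {a p} {A : Set a} {P : Pred A p} (P? : Decidable P) (xs : List A) →
  xs ↭ filter P? xs ++ filter (∁? P?) xs
↭-filter-split P? []       = refl
↭-filter-split P? (x ∷ xs) with P? x
... | yes _ = prep x (↭-filter-split P? xs)
... | no  _ = ↭-trans (prep x (↭-filter-split P? xs))
                      (↭-sym (shift x (filter P? xs) (filter (∁? P?) xs)))

nonneg-sum-zero : ∀ {a b : ℤ} → + 0 ≤ a → + 0 ≤ b → a + b ≡ + 0 → a ≡ + 0 × b ≡ + 0
nonneg-sum-zero {+ m} (+≤+ _) (+≤+ _) eq =
  cong +_ (ℕP.m+n≡0⇒m≡0 m (ℤP.+-injective eq)) , cong +_ (ℕP.m+n≡0⇒n≡0 m (ℤP.+-injective eq))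

module AtNode {n : ℕ} (v : Fin n) where

  OneAt : Pred (Labeling n) 0ℓ
  OneAt H = lookup H v ≡ + 1

  oneAt? : Decidable OneAt
  oneAt? H = lookup H v ≟ + 1

  BinaryAt : Pred (Labeling n) 0ℓ
  BinaryAt H = lookup H v ≡ + 0 ⊎ lookup H v ≡ + 1

  count-ones : ∀ {L : List (Labeling n)} → All BinaryAt L →
    lookup (Σᴸ L) v ≡ + length (filter oneAt? L)
  count-ones                 []       = lookup-replicate v (+ 0)
  count-ones {x ∷ L} (b ∷ bs) with oneAt? x | b
  ... | yes x₁ | _      = ≡-trans (lookup-⊕ x (Σᴸ L) v) (cong₂ _+_ x₁ (count-ones bs))
  ... | no  _  | inj₁ x₀ = ≡-trans (lookup-⊕ x (Σᴸ L) v) (cong₂ _+_ x₀ (count-ones bs))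
  ... | no ¬x₁ | inj₂ x₁ = ⊥-elim (¬x₁ x₁)

  sum-of-ones : ∀ {L : List (Labeling n)} → All OneAt L → lookup (Σᴸ L) v ≡ + length L
  sum-of-ones         []       = lookup-replicate v (+ 0)
  sum-of-ones {x ∷ L} (p ∷ ps) = ≡-trans (lookup-⊕ x (Σᴸ L) v) (cong₂ _+_ p (sum-of-ones ps))

  zero-sum-at : ∀ {E : Edges n} {L : List (Labeling n)} → All (Standard E) L →
    lookup (Σᴸ L) v ≡ + 0 → All (λ x → lookup x v ≡ + 0) L
  zero-sum-at         []       _  = []
  zero-sum-at {L = x ∷ L} (s ∷ ss) eq =
    proj₁ both-zero ∷ zero-sum-at ss (proj₂ both-zero)
    where
    both-zero : lookup x v ≡ + 0 × lookup (Σᴸ L) v ≡ + 0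
    both-zero = nonneg-sum-zero (proj₁ s v) (proj₁ (standard-Σᴸ ss) v)
                                (≡-trans (sym (lookup-⊕ x (Σᴸ L) v)) eq)

  module _ {E : Edges n} {G : Labeling n} where

    SplitPair : List (Labeling n) → List (Labeling n) → Set
    SplitPair H H′ = StdVDecomp E G v H × StdDecomp E (G ⊖ Σᴸ H) H′

    -- The members of H′ all vanish at v: G ⊖ ΣH is 0 at v.
    rest-avoids-v : ∀ {H H′} → SplitPair H H′ → All (∁ OneAt) H′
    rest-avoids-v {H} {H′} ((vH , _ , |H|≡Gv) , (comps′ , ΣH′≡)) =
      All.map (λ x₀ x₁ → 0≢1 (≡-trans (sym x₀) x₁))
              (zero-sum-at (components-standard (G ⊖ Σᴸ H) comps′) ΣH′-at-v)
      where
      open ≡-Reasoning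
      0≢1 : + 0 ≢ + 1
      0≢1 ()
      ΣH′-at-v : lookup (Σᴸ H′) v ≡ + 0
      ΣH′-at-v = begin
        lookup (Σᴸ H′) v             ≡⟨ cong (λ g → lookup g v) ΣH′≡ ⟩
        lookup (G ⊖ Σᴸ H) v          ≡⟨ lookup-⊖ G (Σᴸ H) v ⟩
        lookup G v - lookup (Σᴸ H) v ≡⟨ cong (_-_ (lookup G v)) (≡-trans (sum-of-ones (All.map proj₂ vH)) |H|≡Gv) ⟩
        lookup G v - lookup G v      ≡⟨ ℤP.+-inverseʳ (lookup G v) ⟩
        + 0                          ∎

    ones-recover : ∀ {H H′} → SplitPair H H′ → filter oneAt? (H ++ H′) ≡ H
    ones-recover {H} {H′} pair@((vH , _) , _) = begin
      filter oneAt? (H ++ H′)                   ≡⟨ LP.filter-++ oneAt? H H′ ⟩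
      filter oneAt? H ++ filter oneAt? H′       ≡⟨ cong₂ _++_ (LP.filter-all oneAt? (All.map proj₂ vH))
                                                              (LP.filter-none oneAt? (rest-avoids-v pair)) ⟩
      H ++ []                                   ≡⟨ LP.++-identityʳ H ⟩
      H                                         ∎
      where open ≡-Reasoning

    others-recover : ∀ {H H′} → SplitPair H H′ → filter (∁? oneAt?) (H ++ H′) ≡ H′
    others-recover {H} {H′} pair@((vH , _) , _) = begin
      filter (∁? oneAt?) (H ++ H′)
        ≡⟨ LP.filter-++ (∁? oneAt?) H H′ ⟩
      filter (∁? oneAt?) H ++ filter (∁? oneAt?) H′
        ≡⟨ cong₂ _++_ (LP.filter-none (∁? oneAt?) (All.map (λ x₁ ¬x₁ → ¬x₁ x₁) (All.map proj₂ vH)))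
                      (LP.filter-all (∁? oneAt?) (rest-avoids-v pair)) ⟩
      H′
        ∎
      where open ≡-Reasoning

    decomp⇒split : ∀ {M} → StdDecomp E G M →
      ∃₂ (λ H H′ → StdVDecomp E G v H × StdDecomp E (G ⊖ Σᴸ H) H′ × (M ↭ H ++ H′))
    decomp⇒split {M} (comps , ΣM≡G) =
      H , H′ , (vH , remainder-standard , |H|≡Gv) , (rest-decomp , sym remainder≡) , M↭H++H′
      where
      H  = filter oneAt? M
      H′ = filter (∁? oneAt?) M
      M↭H++H′ = ↭-filter-split oneAt? M
      comps′ : All (StdComponent E G) H′
      comps′ = AllP.filter⁺ (∁? oneAt?) comps
      remainder≡ : G ⊖ Σᴸ H ≡ Σᴸ H′
      remainder≡ = ⊖-unique (≡-trans (sym (Σᴸ-++ H H′)) (≡-trans (sym (Σᴸ-↭ M↭H++H′)) ΣM≡G))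
      vH : All (λ x → StdComponent E G x × OneAt x) H
      vH = All.zip (AllP.filter⁺ oneAt? comps , AllP.all-filter oneAt? M)
      remainder-standard : Standard E (G ⊖ Σᴸ H)
      remainder-standard = subst (Standard E) (sym remainder≡)
                                 (standard-Σᴸ (components-standard G comps′))
      |H|≡Gv : + length H ≡ lookup G v
      |H|≡Gv = sym (≡-trans (cong (λ g → lookup g v) (sym ΣM≡G))
                            (count-ones (All.map (λ c → proj₁ c v) comps)))
      rest-decomp : All (StdComponent E (G ⊖ Σᴸ H)) H′
      rest-decomp = subst (λ g → All (StdComponent E g) H′) (sym remainder≡)
                          (proj₁ (decomposes-own-sum G comps′))

    split⇒decomp : ∀ {M H H′} → SplitPair H H′ → M ↭ H ++ H′ → StdDecomp E G M
    split⇒decomp {M} {H} {H′} ((vH , _ , _) , (comps′ , ΣH′≡)) M↭H++H′ =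
      All-resp-↭ (↭-sym M↭H++H′)
        (AllP.++⁺ (All.map proj₁ vH) (All.map (component-lift G (Σᴸ H) ΣH-standard) comps′))
      , ΣM≡G
      where
      open ≡-Reasoning
      ΣH-standard : Standard E (Σᴸ H)
      ΣH-standard = standard-Σᴸ (components-standard G (All.map proj₁ vH))
      ΣM≡G : Σᴸ M ≡ G
      ΣM≡G = begin
        Σᴸ M               ≡⟨ Σᴸ-↭ M↭H++H′ ⟩
        Σᴸ (H ++ H′)       ≡⟨ Σᴸ-++ H H′ ⟩
        Σᴸ H ⊕ Σᴸ H′       ≡⟨ cong (Σᴸ H ⊕_) ΣH′≡ ⟩
        Σᴸ H ⊕ (G ⊖ Σᴸ H)  ≡⟨ ⊕-⊖-restore (Σᴸ H) G ⟩
        G                  ∎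

    split-unique : ∀ {H₁ H₁′ H₂ H₂′} → SplitPair H₁ H₁′ → SplitPair H₂ H₂′ →
      (H₁ ++ H₁′) ↭ (H₂ ++ H₂′) → (H₁ ↭ H₂) × (H₁′ ↭ H₂′)
    split-unique pair₁ pair₂ p =
        subst₂ _↭_ (ones-recover pair₁) (ones-recover pair₂) (filter-↭ oneAt? p)
      , subst₂ _↭_ (others-recover pair₁) (others-recover pair₂) (filter-↭ (∁? oneAt?) p)

proposition3p3 : ∀ {n} (E : Edges n) → NoLoops E → (G : Labeling n) (v : Fin n) →
    (∀ (M : List (Labeling n)) →
    StdDecomp E G M ⇔
    ∃₂ (λ H H′ → StdVDecomp E G v H × StdDecomp E (G ⊖ Σᴸ H) H′ × (M ↭ H ++ H′)))
    × (∀ (H₁ H₁′ H₂ H₂′ : List (Labeling n)) →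
    StdVDecomp E G v H₁ → StdDecomp E (G ⊖ Σᴸ H₁) H₁′ →
    StdVDecomp E G v H₂ → StdDecomp E (G ⊖ Σᴸ H₂) H₂′ →
    (H₁ ++ H₁′) ↭ (H₂ ++ H₂′) → (H₁ ↭ H₂) × (H₁′ ↭ H₂′))
proposition3p3 E _ G v =
    (λ M → mk⇔ decomp⇒split (λ { (H , H′ , vd , d′ , p) → split⇒decomp (vd , d′) p }))
  , λ H₁ H₁′ H₂ H₂′ vd₁ d₁ vd₂ d₂ → split-unique (vd₁ , d₁) (vd₂ , d₂)
  where open AtNode v
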